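{- Let $T'$ be a plane tree on $d$ vertices and $p$ an integer with $1\le p\le d$. Then there is a unique (up to isomorphism of plane trees) plane tree $T$ on $d+1$ vertices such that the vertex $u$ of $T$ with postorder label $p$ is a type $(1)$ special vertex and removing $u$ from $T$ yields $T'$. Furthermore, for each $\tau\in\{0,1,2\}$ and each nonroot vertex $v\ne u$ of $T$ with postorder label at most $p-1$, $v$ is a type $(\tau)$ special vertex in $T$ if and only if it is a type $(\tau)$ special vertex in $T'$.
   Context: A plane tree is a rooted tree whose children at each vertex are linearly ordered left to right; the first is the leftmost child; a leaf has no children. Postorder labeling of a plane tree on $n$ vertices: remove the root, label the subtrees rooted at the root's children, left to right, consecutively and each recursively in postorder, then give the root label $n$. Removal of a nonroot vertex $v$ with parent $w$: delete $v$ and replace $v$ in the ordered list of children of $w$ by the ordered list of children of $v$. Special vertices: type $(0)$: a leaf that is the leftmost child of its parent, whose parent is not the root; type $(1)$: a leaf that is either the leftmost child of the root or not the leftmost child of its parent; type $(2)$: a non-leaf that is the leftmost child of its parent. -}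

module Defs where

open import Data.Nat using (ℕ; zero; suc; _+_; _≟_)
open import Data.Bool using (Bool; true; false; _∧_; _∨_; not; if_then_else_)
open import Data.List using (List; []; _∷_; _++_)
open import Data.Maybe using (Maybe; just; nothing; _<∣>_)
open import Data.Product using (_×_; _,_; proj₁)
open import Data.Empty using (⊥)
open import Data.Unit using (⊤)
open import Relation.Nullary using (yes; no)

-- Plane trees: a vertex with an ordered (left-to-right) list of children.
-- Two plane trees are isomorphic iff they are equal as values of this type.
data PTree : Set where
  node : List PTree → PTree

mutual
  size : PTree → ℕ
  size (node ts) = suc (sizeF ts)

  sizeF : List PTree → ℕ
  sizeF [] = zero
  sizeF (t ∷ ts) = size t + sizeF ts

data LTree : Set where
  lnode : ℕ → List LTree → LTree

mutual
  erase : LTree → PTree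
  erase (lnode _ cs) = node (eraseF cs)

  eraseF : List LTree → List PTree
  eraseF [] = []
  eraseF (c ∷ cs) = erase c ∷ eraseF cs

-- Postorder labelling. labelT k t labels t with k+1, k+2, ..., k + size t
-- (children subtrees left to right recursively, then the root), and
-- returns the last label used.
mutual
  labelT : ℕ → PTree → LTree × ℕ
  labelT k (node ts) with labelF k ts
  ... | ls , k' = lnode (suc k') ls , suc k'

  labelF : ℕ → List PTree → List LTree × ℕ
  labelF k [] = [] , k
  labelF k (t ∷ ts) with labelT k t
  ... | l , k₁ with labelF k₁ ts
  ...   | ls , k₂ = l ∷ ls , k₂

postorder : PTree → LTree
postorder t = proj₁ (labelT 0 t)

-- Removal of the nonroot vertex with label p: delete it and replace it in
-- the ordered list of children of its parent by its own ordered list of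
-- children.  The remaining vertices keep their labels.
mutual
  removeF : ℕ → List LTree → List LTree
  removeF p [] = []
  removeF p (lnode q cs ∷ ts) with q ≟ p
  ... | yes _ = cs ++ removeF p ts
  ... | no _  = lnode q (removeF p cs) ∷ removeF p ts

removeV : ℕ → LTree → LTree
removeV p (lnode r cs) = lnode r (removeF p cs)

record VInfo : Set where
  constructor vinfo
  field
    isLeaf       : Bool
    isLeftmost   : Bool
    parentIsRoot : Bool

null : {A : Set} → List A → Bool
null [] = true
null (_ ∷ _) = false

-- search the vertex labelled q among a list of sibling subtrees;
-- pr : whether the parent of these siblings is the root,
-- lm : whether the first tree of the list is the leftmost child.
findC : Bool → Bool → ℕ → List LTree → Maybe VInfo
findC pr lm q [] = nothing
findC pr lm q (lnode r cs ∷ ts) with r ≟ q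
... | yes _ = just (vinfo (null cs) lm pr)
... | no _  = findC false true q cs <∣> findC pr false q ts

nonrootInfo : LTree → ℕ → Maybe VInfo
nonrootInfo (lnode _ cs) q = findC true true q cs

data SType : Set where
  τ0 τ1 τ2 : SType

special : SType → VInfo → Bool
special τ0 (vinfo lf lm pr) = lf ∧ lm ∧ not pr
special τ1 (vinfo lf lm pr) = lf ∧ ((lm ∧ pr) ∨ not lm)
special τ2 (vinfo lf lm pr) = not lf ∧ lm

IsSpecialL : SType → LTree → ℕ → Set
IsSpecialL τ t q with nonrootInfo t q
... | nothing = ⊥
... | just i with special τ i
...   | true = ⊤
...   | false = ⊥

IsSpecial : SType → PTree → ℕ → Set
IsSpecial τ T q = IsSpecialL τ (postorder T) q

removeLabelled : ℕ → PTree → LTree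
removeLabelled p T = removeV p (postorder T)

module Submission where

-- Removing the vertex u labelled p from T and putting it back
-- are inverse operations once we know where u sits.  We record a valid
-- position for a new leaf with label q in a forest whose postorder labels
-- start after k as an inductive witness  Slot k q ts  (a new first leaf, a
-- position inside the first tree, or a position after the first tree), and
-- insertAt s  is the forest with that leaf inserted.  Working with the
-- explicit labelling  postF k  (shown equal to the library's  postorder),
-- we prove by induction on the slot that
--   * the new leaf has label q and is of type (1) (leftmost leaves are only
--     created below the root);
--   * removing it gives back the original forest;
--   * vertices with smaller labels keep their local information;
-- and conversely that a forest with a type (1) vertex labelled q decomposes
-- as  insertAt s  of its removal, where any two slots give the same result.
-- Every label range argument reduces to: labels of  postF k ts  are exactly
-- k+1, ..., k + sizeF ts.

open import Defs
open import Data.Nat using (ℕ; suc; _≤_; _∸_)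
open import Data.Product using (Σ; _×_)
open import Function.Bundles using (_⇔_)
open import Relation.Binary.PropositionalEquality using (_≡_)

open import Data.Nat using (zero; _+_; _<_; _≟_; z≤n; s≤s; _≤?_)
open import Data.Nat.Properties
open import Data.Bool using (Bool; true; false; T)
open import Data.List using (List; []; _∷_; _++_)
open import Data.Maybe using (Maybe; just; nothing; _<∣>_)
open import Data.Maybe.Properties using (<∣>-identityʳ)
open import Data.Product using (_,_; proj₁; proj₂)
open import Data.Sum using (_⊎_; inj₁; inj₂)
open import Data.Empty using (⊥; ⊥-elim)
open import Data.Unit using (tt)
open import Function.Related.Propositional using (≡⇒; equivalence)
open import Relation.Nullary using (yes; no; ¬_)
open import Relation.Binary.PropositionalEquality
  using (refl; sym; trans; cong; cong₂; subst; module ≡-Reasoning)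

mutual
  postT : ℕ → PTree → LTree
  postT k (node ts) = lnode (k + suc (sizeF ts)) (postF k ts)

  postF : ℕ → List PTree → List LTree
  postF k [] = []
  postF k (t ∷ ts) = postT k t ∷ postF (k + size t) ts

mutual
  labelT≡postT : (k : ℕ) (t : PTree) → labelT k t ≡ (postT k t , k + size t)
  labelT≡postT k (node ts) rewrite labelF≡postF k ts | +-suc k (sizeF ts) = refl

  labelF≡postF : (k : ℕ) (ts : List PTree) → labelF k ts ≡ (postF k ts , k + sizeF ts)
  labelF≡postF k [] rewrite +-identityʳ k = refl
  labelF≡postF k (t ∷ ts)
    rewrite labelT≡postT k t | labelF≡postF (k + size t) ts | +-assoc k (size t) (sizeF ts) = refl

postorder≡postT : (t : PTree) → postorder t ≡ postT 0 t
postorder≡postT t = cong proj₁ (labelT≡postT 0 t)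

eraseF-postF : (k : ℕ) (ts : List PTree) → eraseF (postF k ts) ≡ ts
eraseF-postF k [] = refl
eraseF-postF k (node cs ∷ rest) =
  cong₂ _∷_ (cong node (eraseF-postF k cs)) (eraseF-postF (k + suc (sizeF cs)) rest)

SpecialInfo : SType → Maybe VInfo → Set
SpecialInfo τ nothing = ⊥
SpecialInfo τ (just i) = T (special τ i)

IsSpecialL≡SpecialInfo : (τ : SType) (t : LTree) (q : ℕ) →
                         IsSpecialL τ t q ≡ SpecialInfo τ (nonrootInfo t q)
IsSpecialL≡SpecialInfo τ t q with nonrootInfo t q
... | nothing = refl
... | just i with special τ i
...   | true = refl
...   | false = refl

specialInfo-left : (τ : SType) (m m′ : Maybe VInfo) → SpecialInfo τ m → SpecialInfo τ (m <∣> m′)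
specialInfo-left τ (just i) m′ sp = sp

specialInfo-nothingʳ : (τ : SType) (m m′ : Maybe VInfo) → m′ ≡ nothing →
                       SpecialInfo τ (m <∣> m′) → SpecialInfo τ m
specialInfo-nothingʳ τ m .nothing refl = subst (SpecialInfo τ) (<∣>-identityʳ m)

specialInfo-nothingˡ : (τ : SType) (m m′ : Maybe VInfo) → m ≡ nothing →
                       SpecialInfo τ (m <∣> m′) → SpecialInfo τ m′
specialInfo-nothingˡ τ .nothing m′ refl sp = sp

leftmost-nonroot-not-type1 : (lf : Bool) → ¬ T (special τ1 (vinfo lf true false))
leftmost-nonroot-not-type1 true ()
leftmost-nonroot-not-type1 false ()

findC-self : (pr lm : Bool) (q : ℕ) (X Y : List LTree) →
             findC pr lm q (lnode q X ∷ Y) ≡ just (vinfo (null X) lm pr)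
findC-self pr lm q X Y with q ≟ q
... | yes _ = refl
... | no q≢q = ⊥-elim (q≢q refl)

findC-other : (pr lm : Bool) {L q : ℕ} (X Y : List LTree) → ¬ L ≡ q →
              findC pr lm q (lnode L X ∷ Y) ≡ (findC false true q X <∣> findC pr false q Y)
findC-other pr lm {L} {q} X Y L≢q with L ≟ q
... | yes L≡q = ⊥-elim (L≢q L≡q)
... | no _ = refl

findC-tail-cong : (pr lm : Bool) (q L : ℕ) (X Y Y′ : List LTree) →
                  findC pr false q Y ≡ findC pr false q Y′ →
                  findC pr lm q (lnode L X ∷ Y) ≡ findC pr lm q (lnode L X ∷ Y′)
findC-tail-cong pr lm q L X Y Y′ eq with L ≟ q
... | yes _ = refl
... | no _ = cong (findC false true q X <∣>_) eq

removeF-self : (q : ℕ) (X Y : List LTree) → removeF q (lnode q X ∷ Y) ≡ X ++ removeF q Y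
removeF-self q X Y with q ≟ q
... | yes _ = refl
... | no q≢q = ⊥-elim (q≢q refl)

removeF-other : {L q : ℕ} (X Y : List LTree) → ¬ L ≡ q →
                removeF q (lnode L X ∷ Y) ≡ lnode L (removeF q X) ∷ removeF q Y
removeF-other {L} {q} X Y L≢q with L ≟ q
... | yes L≡q = ⊥-elim (L≢q L≡q)
... | no _ = refl

Outside : ℕ → ℕ → ℕ → Set
Outside k n r = r ≤ k ⊎ k + n < r

outside-children : ∀ k a b r → Outside k (suc a + b) r → Outside k a r
outside-children k a b r (inj₁ r≤k) = inj₁ r≤k
outside-children k a b r (inj₂ k+n<r) =
  inj₂ (≤-<-trans (+-monoʳ-≤ k (≤-trans (n≤1+n a) (m≤m+n (suc a) b))) k+n<r)

outside-siblings : ∀ k a b r → Outside k (suc a + b) r → Outside (k + suc a) b r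
outside-siblings k a b r (inj₁ r≤k) = inj₁ (≤-trans r≤k (m≤m+n k (suc a)))
outside-siblings k a b r (inj₂ k+n<r) = inj₂ (subst (_< r) (sym (+-assoc k (suc a) b)) k+n<r)

outside-root : ∀ k a b r → Outside k (suc a + b) r → ¬ k + suc a ≡ r
outside-root k a b r (inj₁ r≤k) refl = ≤⇒≯ r≤k (m<m+n k (s≤s z≤n))
outside-root k a b r (inj₂ k+n<r) refl = ≤⇒≯ (+-monoʳ-≤ k (m≤m+n (suc a) b)) k+n<r

beyond-children : (k a q : ℕ) → k + suc a < q → Outside k a q
beyond-children k a q root<q = inj₂ (<-trans (+-monoʳ-< k (n<1+n a)) root<q)

findC-outside : (pr lm : Bool) (k r : ℕ) (ts : List PTree) → Outside k (sizeF ts) r →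
                findC pr lm r (postF k ts) ≡ nothing
findC-outside pr lm k r [] out = refl
findC-outside pr lm k r (node cs ∷ rest) out
  rewrite findC-other pr lm (postF k cs) (postF (k + suc (sizeF cs)) rest)
            (outside-root k (sizeF cs) (sizeF rest) r out)
        | findC-outside false true k r cs (outside-children k (sizeF cs) (sizeF rest) r out)
  = findC-outside pr false (k + suc (sizeF cs)) r rest (outside-siblings k (sizeF cs) (sizeF rest) r out)

removeF-outside : (k r : ℕ) (ts : List PTree) → Outside k (sizeF ts) r → removeF r (postF k ts) ≡ postF k ts
removeF-outside k r [] out = refl
removeF-outside k r (node cs ∷ rest) out
  rewrite removeF-other (postF k cs) (postF (k + suc (sizeF cs)) rest)
            (outside-root k (sizeF cs) (sizeF rest) r out)
        | removeF-outside k r cs (outside-children k (sizeF cs) (sizeF rest) r out)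
        | removeF-outside (k + suc (sizeF cs)) r rest (outside-siblings k (sizeF cs) (sizeF rest) r out)
  = refl

eraseF-removeF-outside : (k r : ℕ) (ts : List PTree) → Outside k (sizeF ts) r →
                         eraseF (removeF r (postF k ts)) ≡ ts
eraseF-removeF-outside k r ts out = trans (cong eraseF (removeF-outside k r ts out)) (eraseF-postF k ts)

found⇒above : (τ : SType) (pr lm : Bool) (k q : ℕ) (ts : List PTree) →
              SpecialInfo τ (findC pr lm q (postF k ts)) → k < q
found⇒above τ pr lm k q ts sp with q ≤? k
... | yes q≤k = ⊥-elim (subst (SpecialInfo τ) (findC-outside pr lm k q ts (inj₁ q≤k)) sp)
... | no q≰k = ≰⇒> q≰k

-- In the child forest of a non-root vertex, the first label k+1 belongs to a
-- leftmost leaf, so it is not of type (1).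
first-not-type1 : (k : ℕ) (ts : List PTree) → ¬ SpecialInfo τ1 (findC false true (k + 1) (postF k ts))
first-not-type1 k [] ()
first-not-type1 k (node cs ∷ rest) sp with k + suc (sizeF cs) ≟ k + 1
... | yes _ = leftmost-nonroot-not-type1 (null (postF k cs)) sp
... | no _ =
  first-not-type1 k cs (specialInfo-nothingʳ τ1 (findC false true (k + 1) (postF k cs)) _ later-nothing sp)
  where
    later-nothing : findC false false (k + 1) (postF (k + suc (sizeF cs)) rest) ≡ nothing
    later-nothing = findC-outside false false _ (k + 1) rest (inj₁ (+-monoʳ-≤ k (s≤s z≤n)))

-- Slot k q ts: a place where a new leaf receives the label q when the
-- forest ts (with a leaf inserted) is labelled starting after k.
data Slot (k : ℕ) : ℕ → List PTree → Set where
  front  : {ts : List PTree} → Slot k (k + 1) ts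
  -- inside the first tree, but not as the very first vertex
  inside : {q : ℕ} {cs rest : List PTree} → k + 1 < q → Slot k q cs → Slot k q (node cs ∷ rest)
  after  : {q : ℕ} {cs rest : List PTree} → Slot (k + size (node cs)) q rest → Slot k q (node cs ∷ rest)

insertAt : {k q : ℕ} {ts : List PTree} → Slot k q ts → List PTree
insertAt {ts = ts} front = node [] ∷ ts
insertAt {ts = node cs ∷ rest} (inside _ s) = node (insertAt s) ∷ rest
insertAt {ts = node cs ∷ rest} (after s) = node cs ∷ insertAt s

insertAt-size : {k q : ℕ} {ts : List PTree} (s : Slot k q ts) → sizeF (insertAt s) ≡ suc (sizeF ts)
insertAt-size front = refl
insertAt-size {ts = node cs ∷ rest} (inside _ s) = cong (λ n → suc n + sizeF rest) (insertAt-size s)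
insertAt-size {ts = node cs ∷ rest} (after s) =
  trans (cong (suc (sizeF cs) +_) (insertAt-size s)) (+-suc (suc (sizeF cs)) (sizeF rest))

past-first-tree : (k a b : ℕ) → (k + suc a) + suc b ≡ k + suc (suc a + b)
past-first-tree k a b = trans (+-assoc k (suc a) (suc b)) (cong (k +_) (+-suc (suc a) b))

slot-bounds : {k q : ℕ} {ts : List PTree} → Slot k q ts → k < q × q ≤ k + suc (sizeF ts)
slot-bounds {k} {ts = ts} front = m<m+n k (s≤s z≤n) , +-monoʳ-≤ k (s≤s z≤n)
slot-bounds {k} {ts = node cs ∷ rest} (inside k+1<q s) =
  <-trans (m<m+n k (s≤s z≤n)) k+1<q ,
  ≤-trans (proj₂ (slot-bounds s))
          (+-monoʳ-≤ k (s≤s (≤-trans (n≤1+n _) (m≤m+n (suc (sizeF cs)) (sizeF rest)))))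
slot-bounds {k} {q} {node cs ∷ rest} (after s) with slot-bounds s
... | first<q , q≤ =
  ≤-<-trans (m≤m+n k _) first<q , subst (q ≤_) (past-first-tree k (sizeF cs) (sizeF rest)) q≤

label-below-root : {k q : ℕ} {ts : List PTree} (s : Slot k q ts) → q < k + suc (sizeF (insertAt s))
label-below-root {k} s rewrite insertAt-size s = ≤-<-trans (proj₂ (slot-bounds s)) (+-monoʳ-< k (n<1+n _))

slot : (k q : ℕ) (ts : List PTree) → k < q → q ≤ k + suc (sizeF ts) → Slot k q ts
slot k q ts k<q q≤ with q ≟ k + 1
... | yes refl = front
... | no q≢k+1 with ts | ≤∧≢⇒< (subst (_≤ q) (+-comm 1 k) k<q) (λ e → q≢k+1 (sym e))
...   | [] | k+1<q = ⊥-elim (≤⇒≯ q≤ k+1<q)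
...   | node cs ∷ rest | k+1<q with q ≤? k + suc (sizeF cs)
...     | yes q≤first = inside k+1<q (slot k q cs k<q q≤first)
...     | no q≰first =
  after (slot (k + suc (sizeF cs)) q rest (≰⇒> q≰first)
          (subst (q ≤_) (sym (past-first-tree k (sizeF cs) (sizeF rest))) q≤))

insertAt-unique : {k q : ℕ} {ts : List PTree} (s s′ : Slot k q ts) → insertAt s ≡ insertAt s′
insertAt-unique front front = refl
insertAt-unique front (inside k+1<k+1 _) = ⊥-elim (<-irrefl refl k+1<k+1)
insertAt-unique {k} front (after s′) = ⊥-elim (≤⇒≯ (+-monoʳ-≤ k (s≤s z≤n)) (proj₁ (slot-bounds s′)))
insertAt-unique (inside k+1<k+1 _) front = ⊥-elim (<-irrefl refl k+1<k+1)
insertAt-unique {ts = _ ∷ rest} (inside _ s) (inside _ s′) =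
  cong (λ cs → node cs ∷ rest) (insertAt-unique s s′)
insertAt-unique (inside _ s) (after s′) = ⊥-elim (≤⇒≯ (proj₂ (slot-bounds s)) (proj₁ (slot-bounds s′)))
insertAt-unique {k} (after s) front = ⊥-elim (≤⇒≯ (+-monoʳ-≤ k (s≤s z≤n)) (proj₁ (slot-bounds s)))
insertAt-unique (after s) (inside _ s′) = ⊥-elim (≤⇒≯ (proj₂ (slot-bounds s′)) (proj₁ (slot-bounds s)))
insertAt-unique {ts = node cs ∷ _} (after s) (after s′) = cong (node cs ∷_) (insertAt-unique s s′)

erase-remove-insertAt : {k q : ℕ} {ts : List PTree} (s : Slot k q ts) →
                        eraseF (removeF q (postF k (insertAt s))) ≡ ts
erase-remove-insertAt {k} {ts = ts} front =
  trans (cong eraseF (removeF-self (k + 1) [] (postF (k + 1) ts)))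
        (eraseF-removeF-outside (k + 1) (k + 1) ts (inj₁ ≤-refl))
erase-remove-insertAt {k} {q} {node cs ∷ rest} (inside _ s)
  rewrite removeF-other (postF k (insertAt s)) (postF (k + suc (sizeF (insertAt s))) rest)
            (>⇒≢ (label-below-root s))
  = cong₂ _∷_ (cong node (erase-remove-insertAt s))
              (eraseF-removeF-outside _ q rest (inj₁ (<⇒≤ (label-below-root s))))
erase-remove-insertAt {k} {q} {node cs ∷ rest} (after s)
  rewrite removeF-other (postF k cs) (postF (k + suc (sizeF cs)) (insertAt s))
            (<⇒≢ (proj₁ (slot-bounds s)))
  = cong₂ _∷_ (cong node (eraseF-removeF-outside k q cs
                            (beyond-children k (sizeF cs) q (proj₁ (slot-bounds s)))))
              (erase-remove-insertAt s)

LeafType1 : Bool → Bool → Set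
LeafType1 pr lm = T (special τ1 (vinfo true lm pr))

-- The inserted leaf is of type (1), provided a new first leaf of this forest
-- would be (a leftmost leaf is only type (1) directly below the root).
insertAt-type1 : (pr lm : Bool) {k q : ℕ} {ts : List PTree} (s : Slot k q ts) →
                 (q ≡ k + 1 → LeafType1 pr lm) → SpecialInfo τ1 (findC pr lm q (postF k (insertAt s)))
insertAt-type1 pr lm {k} {ts = ts} front ok
  rewrite findC-self pr lm (k + 1) [] (postF (k + 1) ts) = ok refl
insertAt-type1 pr lm {k} {q} {node cs ∷ rest} (inside k+1<q s) ok
  rewrite findC-other pr lm (postF k (insertAt s)) (postF (k + suc (sizeF (insertAt s))) rest)
            (>⇒≢ (label-below-root s))
  = specialInfo-left τ1 (findC false true q (postF k (insertAt s)))
                     (findC pr false q (postF (k + suc (sizeF (insertAt s))) rest))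
      (insertAt-type1 false true s (λ q≡k+1 → ⊥-elim (<-irrefl (sym q≡k+1) k+1<q)))
insertAt-type1 pr lm {k} {q} {node cs ∷ rest} (after s) ok
  rewrite findC-other pr lm (postF k cs) (postF (k + suc (sizeF cs)) (insertAt s))
            (<⇒≢ (proj₁ (slot-bounds s)))
        | findC-outside false true k q cs (beyond-children k (sizeF cs) q (proj₁ (slot-bounds s)))
  = insertAt-type1 pr false s (λ _ → tt)

insertAt-earlier : (pr lm : Bool) {k q : ℕ} {ts : List PTree} (s : Slot k q ts) (r : ℕ) → r < q →
                   findC pr lm r (removeF q (postF k (insertAt s))) ≡ findC pr lm r (postF k (insertAt s))
insertAt-earlier pr lm {k} {ts = ts} front r r<k+1 = begin
    findC pr lm r (removeF (k + 1) (lnode (k + 1) [] ∷ P))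
  ≡⟨ cong (findC pr lm r) (removeF-self (k + 1) [] P) ⟩
    findC pr lm r (removeF (k + 1) P)
  ≡⟨ cong (findC pr lm r) (removeF-outside (k + 1) (k + 1) ts (inj₁ ≤-refl)) ⟩
    findC pr lm r P
  ≡⟨ findC-outside pr lm (k + 1) r ts (inj₁ (<⇒≤ r<k+1)) ⟩
    nothing
  ≡⟨ sym (findC-outside pr false (k + 1) r ts (inj₁ (<⇒≤ r<k+1))) ⟩
    findC pr false r P
  ≡⟨ sym (findC-other pr lm [] P (>⇒≢ r<k+1)) ⟩
    findC pr lm r (lnode (k + 1) [] ∷ P)
  ∎
  where
    open ≡-Reasoning
    P : List LTree
    P = postF (k + 1) ts
insertAt-earlier pr lm {k} {q} {node cs ∷ rest} (inside _ s) r r<q = begin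
    findC pr lm r (removeF q (lnode L X ∷ Y))
  ≡⟨ cong (findC pr lm r) (removeF-other X Y (>⇒≢ q<L)) ⟩
    findC pr lm r (lnode L (removeF q X) ∷ removeF q Y)
  ≡⟨ findC-other pr lm (removeF q X) (removeF q Y) (>⇒≢ (<-trans r<q q<L)) ⟩
    findC false true r (removeF q X) <∣> findC pr false r (removeF q Y)
  ≡⟨ cong₂ _<∣>_ (insertAt-earlier false true s r r<q)
                 (cong (findC pr false r) (removeF-outside L q rest (inj₁ (<⇒≤ q<L)))) ⟩
    findC false true r X <∣> findC pr false r Y
  ≡⟨ sym (findC-other pr lm X Y (>⇒≢ (<-trans r<q q<L))) ⟩
    findC pr lm r (lnode L X ∷ Y)
  ∎
  where
    open ≡-Reasoning
    L : ℕ
    L = k + suc (sizeF (insertAt s))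
    X Y : List LTree
    X = postF k (insertAt s)
    Y = postF L rest
    q<L : q < L
    q<L = label-below-root s
insertAt-earlier pr lm {k} {q} {node cs ∷ rest} (after s) r r<q
  rewrite removeF-other (postF k cs) (postF (k + suc (sizeF cs)) (insertAt s)) (<⇒≢ (proj₁ (slot-bounds s)))
        | removeF-outside k q cs (beyond-children k (sizeF cs) q (proj₁ (slot-bounds s)))
  = findC-tail-cong pr lm r (k + suc (sizeF cs)) (postF k cs) _ _ (insertAt-earlier pr false s r r<q)

Decomposes : ℕ → ℕ → List PTree → List PTree → Set
Decomposes k q ts′ ts = Σ (Slot k q ts′) (λ s → insertAt s ≡ ts)

retarget : {k q : ℕ} {ts₁ ts₂ ts : List PTree} → ts₁ ≡ ts₂ →
           Decomposes k q ts₁ ts → Decomposes k q ts₂ ts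
retarget refl d = d

decompose : (pr lm : Bool) (k q : ℕ) (ts : List PTree) → SpecialInfo τ1 (findC pr lm q (postF k ts)) →
            Decomposes k q (eraseF (removeF q (postF k ts))) ts
decompose pr lm k q [] ()
decompose pr lm k q (node cs ∷ rest) sp with k + suc (sizeF cs) ≟ q
decompose pr lm k .(k + 1) (node [] ∷ rest) sp | yes refl =
  retarget (sym (eraseF-removeF-outside (k + 1) (k + 1) rest (inj₁ ≤-refl))) (front , refl)
decompose pr lm k _ (node (_ ∷ _) ∷ rest) () | yes refl
... | no _ with q ≤? k + suc (sizeF cs)
...   | yes q≤L =
  inside k+1<q s , cong₂ _∷_ (cong node inserted) (eraseF-removeF-outside _ q rest (inj₁ q≤L))
  where
    sp-cs : SpecialInfo τ1 (findC false true q (postF k cs))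
    sp-cs = specialInfo-nothingʳ τ1 (findC false true q (postF k cs)) _
              (findC-outside pr false _ q rest (inj₁ q≤L)) sp
    k+1≢q : ¬ k + 1 ≡ q
    k+1≢q refl = first-not-type1 k cs sp-cs
    k+1<q : k + 1 < q
    k+1<q = ≤∧≢⇒< (subst (_≤ q) (+-comm 1 k) (found⇒above τ1 false true k q cs sp-cs)) k+1≢q
    s : Slot k q (eraseF (removeF q (postF k cs)))
    s = proj₁ (decompose false true k q cs sp-cs)
    inserted : insertAt s ≡ cs
    inserted = proj₂ (decompose false true k q cs sp-cs)
...   | no q≰L =
  retarget (cong (λ cs′ → node cs′ ∷ eraseF (removeF q (postF L rest)))
                 (sym (eraseF-removeF-outside k q cs before)))
           (after (proj₁ d) , cong (node cs ∷_) (proj₂ d))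
  where
    L : ℕ
    L = k + suc (sizeF cs)
    before : Outside k (sizeF cs) q
    before = beyond-children k (sizeF cs) q (≰⇒> q≰L)
    d : Decomposes L q (eraseF (removeF q (postF L rest))) rest
    d = decompose pr false L q rest
          (specialInfo-nothingˡ τ1 _ (findC pr false q (postF L rest)) (findC-outside false true k q cs before) sp)

removeLabelled-node : (p : ℕ) (ts : List PTree) →
                      removeLabelled p (node ts) ≡ lnode (suc (sizeF ts)) (removeF p (postF 0 ts))
removeLabelled-node p ts = cong (removeV p) (postorder≡postT (node ts))

isSpecial-node : (τ : SType) (ts : List PTree) (q : ℕ) →
                 IsSpecial τ (node ts) q ≡ SpecialInfo τ (findC true true q (postF 0 ts))
isSpecial-node τ ts q =
  trans (cong (λ t → IsSpecialL τ t q) (postorder≡postT (node ts)))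
        (IsSpecialL≡SpecialInfo τ (postT 0 (node ts)) q)

isSpecial-removed : (τ : SType) (p : ℕ) (ts : List PTree) (q : ℕ) →
                    IsSpecialL τ (removeLabelled p (node ts)) q
                      ≡ SpecialInfo τ (findC true true q (removeF p (postF 0 ts)))
isSpecial-removed τ p ts q =
  trans (cong (λ t → IsSpecialL τ t q) (removeLabelled-node p ts))
        (IsSpecialL≡SpecialInfo τ (lnode (suc (sizeF ts)) (removeF p (postF 0 ts))) q)

node-injective : {xs ys : List PTree} → node xs ≡ node ys → xs ≡ ys
node-injective refl = refl

recover : (p : ℕ) (ts : List PTree) (s : Slot 0 p ts) (T₂ : PTree) → IsSpecial τ1 T₂ p →
          erase (removeLabelled p T₂) ≡ node ts → T₂ ≡ node (insertAt s)
recover p ts s (node ts₂) type1 removal with retarget removal-children (decompose true true 0 p ts₂ type1′)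
  where
    removal-children : eraseF (removeF p (postF 0 ts₂)) ≡ ts
    removal-children = node-injective (trans (sym (cong erase (removeLabelled-node p ts₂))) removal)
    type1′ : SpecialInfo τ1 (findC true true p (postF 0 ts₂))
    type1′ = subst (λ A → A) (isSpecial-node τ1 ts₂ p) type1
... | s₂ , inserted₂ = cong node (trans (sym inserted₂) (insertAt-unique s₂ s))

lemma3p8 : (d : ℕ) (T′ : PTree) → size T′ ≡ d → (p : ℕ) → 1 ≤ p → p ≤ d →
    Σ PTree (λ T →
      (size T ≡ suc d × IsSpecial τ1 T p × erase (removeLabelled p T) ≡ T′)
      × ((T₂ : PTree) → size T₂ ≡ suc d → IsSpecial τ1 T₂ p →
           erase (removeLabelled p T₂) ≡ T′ → T₂ ≡ T)
      × ((τ : SType) (q : ℕ) → 1 ≤ q → q ≤ p ∸ 1 →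
           IsSpecial τ T q ⇔ IsSpecialL τ (removeLabelled p T) q))
lemma3p8 d (node ts) size≡d zero () p≤d
lemma3p8 d (node ts) size≡d (suc p′) 1≤p p≤d =
  node (insertAt s) , (size-T , type1 , removal) , (λ T₂ _ → recover p ts s T₂) , preserved
  where
    p : ℕ
    p = suc p′
    s : Slot 0 p ts
    s = slot 0 p ts 1≤p (subst (p ≤_) (sym size≡d) p≤d)
    size-T : size (node (insertAt s)) ≡ suc d
    size-T = cong suc (trans (insertAt-size s) size≡d)
    type1 : IsSpecial τ1 (node (insertAt s)) p
    type1 = subst (λ A → A) (sym (isSpecial-node τ1 (insertAt s) p)) (insertAt-type1 true true s (λ _ → tt))
    removal : erase (removeLabelled p (node (insertAt s))) ≡ node ts
    removal = trans (cong erase (removeLabelled-node p (insertAt s))) (cong node (erase-remove-insertAt s))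
    preserved : (τ : SType) (q : ℕ) → 1 ≤ q → q ≤ p′ →
                IsSpecial τ (node (insertAt s)) q ⇔ IsSpecialL τ (removeLabelled p (node (insertAt s))) q
    preserved τ q _ q≤p′ = ≡⇒ {k = equivalence} (begin
        IsSpecial τ (node (insertAt s)) q
      ≡⟨ isSpecial-node τ (insertAt s) q ⟩
        SpecialInfo τ (findC true true q (postF 0 (insertAt s)))
      ≡⟨ cong (SpecialInfo τ) (sym (insertAt-earlier true true s q (s≤s q≤p′))) ⟩
        SpecialInfo τ (findC true true q (removeF p (postF 0 (insertAt s))))
      ≡⟨ sym (isSpecial-removed τ p (insertAt s) q) ⟩
        IsSpecialL τ (removeLabelled p (node (insertAt s))) q
      ∎)
      where open ≡-Reasoning
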